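{- Let $C>0$. There exists $D=D(C)>0$ such that for every rational point $P=[x:y]\times[s:t]$ of $Y_3$ (integers with $\gcd(x,y)=\gcd(s,t)=1$) satisfying $x\ne y$, $s\ne t$, $xs\ne yt$ and $d(P)\le C$, one has $H(P)\,d(P)^{5/2}\ge D$.
   Context: $Y_3$ is the blow-up of $\mathbb{P}^1\times\mathbb{P}^1$ (coordinates $[x:y]\times[s:t]$) at $[1:0]\times[1:0]$, $[0:1]\times[1:0]$, $[1:0]\times[0:1]$; $Q=[1:1]\times[1:1]$. For $P=[x:y]\times[s:t]$ with coprime integer coordinates, $H(P)=\max(|x^2st|,|y^2st|,|t^2xy|,|s^2xy|,|xyst|,|y^2t^2|)/(\gcd(x,t)\gcd(y,s)\gcd(y,t))$ (anticanonical height) and $d(P)=d(P,Q)=\max(|x/y-1|,|s/t-1|)$.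
   Formalization: The constant C ranges over the positive rationals, and the constant D is taken in ℚ. -}

module Defs where

open import Data.Nat as ℕ using (ℕ; zero; suc)
open import Data.Nat.GCD using () renaming (gcd to gcdℕ)
open import Data.Integer as ℤ using (ℤ; +_; ∣_∣)
open import Data.Rational as ℚ using (ℚ; 0ℚ; _/_)

-- a / b as a rational, for an integer a and a natural b; returns 0 when b = 0
-- (only ever used with b ≠ 0 under the hypotheses of the theorem)
_/'_ : ℤ → ℕ → ℚ
a /' zero  = 0ℚ
a /' suc n = a / suc n

-- |u/v - 1| = |u - v| / |v|   (v ≠ 0 assumed by the theorem)
dist1 : ℤ → ℤ → ℚ
dist1 u v = (+ ∣ u ℤ.- v ∣) /' ∣ v ∣

-- d(P) = d(P,Q) = max(|x/y - 1|, |s/t - 1|), Q = [1:1]×[1:1]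
dQ : ℤ → ℤ → ℤ → ℤ → ℚ
dQ x y s t = dist1 x y ℚ.⊔ dist1 s t

Hnum : ℤ → ℤ → ℤ → ℤ → ℕ
Hnum x y s t =
  ∣ x ℤ.* x ℤ.* s ℤ.* t ∣ ℕ.⊔ ∣ y ℤ.* y ℤ.* s ℤ.* t ∣ ℕ.⊔
  ∣ t ℤ.* t ℤ.* x ℤ.* y ∣ ℕ.⊔ ∣ s ℤ.* s ℤ.* x ℤ.* y ∣ ℕ.⊔
  ∣ x ℤ.* y ℤ.* s ℤ.* t ∣ ℕ.⊔ ∣ y ℤ.* y ℤ.* t ℤ.* t ∣

Hden : ℤ → ℤ → ℤ → ℤ → ℕ
Hden x y s t = gcdℕ (∣ x ∣) (∣ t ∣) ℕ.* gcdℕ (∣ y ∣) (∣ s ∣) ℕ.* gcdℕ (∣ y ∣) (∣ t ∣)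

H : ℤ → ℤ → ℤ → ℤ → ℚ
H x y s t = (+ Hnum x y s t) /' Hden x y s t

{-# OPTIONS --safe #-}
module Submission where

-- Put Y = |y|, T = |t|, U = |x - y|, V = |s - t|, W = |xs - yt|, so d = max(U/Y, V/T); by symmetry
-- say d = U/Y, and let m = |numerator of C| ≥ C.  The gcds a, b, c in the denominator of H are such
-- that bc ∣ Y, ac ∣ T, ab ∣ W with coprime factors, so (abc)² ≤ YTW, while the numerator of H is at
-- least Y²T².  Expanding xs - yt = y(s - t) + (x - y)t + (x - y)(s - t) and using VY ≤ UT, U ≤ mY
-- gives W ≤ (m + 2)UT, and Y ≤ VY ≤ UT.  Multiplying out, G²Y⁵ ≤ N²U⁵(m + 2)² for H = N/G, i.e.
-- H²d⁵ ≥ D² for D = 1/(m + 2).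

module Arithmetic where
  open import Data.Nat
  open import Data.Nat.Properties
  open import Data.List using (_∷_; [])
  open import Data.Nat.Tactic.RingSolver

  cross-difference-linear-bound : ∀ {Y T U V W} m .{{_ : NonZero Y}} →
    W ≤ Y * V + U * T + U * V → V * Y ≤ U * T → U ≤ m * Y → W ≤ suc (suc m) * (U * T)
  cross-difference-linear-bound {Y} {T} {U} {V} {W} m W≤ VY≤UT U≤mY = *-cancelʳ-≤ W _ Y (begin
    W * Y                                    ≤⟨ *-monoˡ-≤ Y W≤ ⟩
    (Y * V + U * T + U * V) * Y              ≡⟨ solve (Y ∷ T ∷ U ∷ V ∷ []) ⟩
    Y * (V * Y) + U * T * Y + U * (V * Y)    ≤⟨ +-mono-≤ (+-monoˡ-≤ (U * T * Y) (*-monoʳ-≤ Y VY≤UT)) (*-monoʳ-≤ U VY≤UT) ⟩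
    Y * (U * T) + U * T * Y + U * (U * T)    ≤⟨ +-monoʳ-≤ (Y * (U * T) + U * T * Y) (*-monoˡ-≤ (U * T) U≤mY) ⟩
    Y * (U * T) + U * T * Y + m * Y * (U * T) ≡⟨ solve (Y ∷ T ∷ U ∷ m ∷ []) ⟩
    suc (suc m) * (U * T) * Y                ∎)
    where open ≤-Reasoning

  height-distance-inequality : ∀ {N G Y T U W K} .{{_ : NonZero U}} .{{_ : NonZero K}} →
    G * G ≤ Y * T * W → Y * Y * T * T ≤ N → W ≤ K * (U * T) → Y ≤ U * T →
    G * G * (Y * Y * Y * Y * Y) ≤ N * N * (U * U * U * U * U) * (K * K)
  height-distance-inequality {N} {G} {Y} {T} {U} {W} {K} G²≤ Y²T²≤N W≤ Y≤UT = begin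
    G * G * (Y * Y * Y * Y * Y)                             ≤⟨ *-monoˡ-≤ (Y * Y * Y * Y * Y) G²≤ ⟩
    Y * T * W * (Y * Y * Y * Y * Y)                         ≤⟨ *-monoˡ-≤ (Y * Y * Y * Y * Y) (*-monoʳ-≤ (Y * T) W≤) ⟩
    Y * T * (K * (U * T)) * (Y * Y * Y * Y * Y)             ≡⟨ solve (Y ∷ T ∷ U ∷ K ∷ []) ⟩
    Y * Y * T * T * (K * U * (Y * Y)) * (Y * Y)             ≤⟨ *-monoʳ-≤ (Y * Y * T * T * (K * U * (Y * Y))) (*-mono-≤ Y≤UT Y≤UT) ⟩
    Y * Y * T * T * (K * U * (Y * Y)) * (U * T * (U * T))   ≡⟨ solve (Y ∷ T ∷ U ∷ K ∷ []) ⟩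
    Y * Y * T * T * (Y * Y * T * T) * (K * U * U * U)       ≤⟨ *-monoʳ-≤ (Y * Y * T * T * (Y * Y * T * T)) (m≤m*n (K * U * U * U) (K * U * U) {{KU²≢0}}) ⟩
    Y * Y * T * T * (Y * Y * T * T) * (K * U * U * U * (K * U * U)) ≡⟨ solve (Y ∷ T ∷ U ∷ K ∷ []) ⟩
    Y * Y * T * T * (Y * Y * T * T) * (U * U * U * U * U) * (K * K) ≤⟨ *-monoˡ-≤ (K * K) (*-monoˡ-≤ (U * U * U * U * U) (*-mono-≤ Y²T²≤N Y²T²≤N)) ⟩
    N * N * (U * U * U * U * U) * (K * K)                   ∎
    where
    open ≤-Reasoning
    KU²≢0 : NonZero (K * U * U)
    KU²≢0 = m*n≢0 (K * U) U {{m*n≢0 K U}}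

  pairwise-products-bound : ∀ {a b c Y T W} → b * c ≤ Y → a * c ≤ T → a * b ≤ W →
    a * b * c * (a * b * c) ≤ Y * T * W
  pairwise-products-bound {a} {b} {c} bc≤Y ac≤T ab≤W = begin
    a * b * c * (a * b * c)   ≡⟨ solve (a ∷ b ∷ c ∷ []) ⟩
    b * c * (a * c) * (a * b) ≤⟨ *-mono-≤ (*-mono-≤ bc≤Y ac≤T) ab≤W ⟩
    _                         ∎
    where open ≤-Reasoning

module PointInvariants where
  open Arithmetic using (pairwise-products-bound)
  open import Defs using (Hnum; Hden)
  open import Data.Nat as ℕ using (ℕ; NonZero; ≢-nonZero; ≢-nonZero⁻¹; _≤_)
  open import Data.Nat.Properties
  open import Data.Nat.Divisibility using (_∣_; ∣-trans; ∣⇒≤)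
  open import Data.Nat.Coprimality using (Coprime; gcd≡1⇒coprime; coprime⇒gcd≡1)
  open import Data.Nat.GCD using (gcd[m,n]∣m; gcd[m,n]∣n; gcd[m,n]≢0) renaming (gcd to gcdℕ)
  open import Data.Nat.LCM using (lcm; lcm-least; gcd*lcm)
  open import Data.Integer as ℤ using (ℤ; +_; 0ℤ; 1ℤ; ∣_∣; _-_)
  open import Data.Integer.Properties using (∣i∣≡0⇒i≡0; i-j≡0⇒i≡j; +-injective; abs-*; ∣i+j∣≤∣i∣+∣j∣)
  open import Data.Integer.Divisibility.Signed using (∣ᵤ⇒∣; ∣⇒∣ᵤ; ∣m∣n⇒∣m-n; ∣m⇒∣m*n; ∣n⇒∣m*n)
  open import Data.Integer.GCD using (gcd)
  open import Data.Integer.Tactic.RingSolver using (solve-∀)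
  open import Data.List using (_∷_; [])
  open import Data.Product using (_,_)
  open import Data.Sum using (inj₁; inj₂)
  open import Function using (_∘_)
  open import Relation.Binary.PropositionalEquality

  ∣∣-nonZero : ∀ {i} → i ≢ 0ℤ → NonZero ∣ i ∣
  ∣∣-nonZero i≢0 = ≢-nonZero (i≢0 ∘ ∣i∣≡0⇒i≡0)

  ∣-∣-nonZero : ∀ {i j} → i ≢ j → NonZero ∣ i - j ∣
  ∣-∣-nonZero {i} {j} i≢j = ∣∣-nonZero (i≢j ∘ i-j≡0⇒i≡j i j)

  gcd-nonZeroˡ : ∀ m n .{{_ : NonZero m}} → NonZero (gcdℕ m n)
  gcd-nonZeroˡ m n = ≢-nonZero (gcd[m,n]≢0 m n (inj₁ (≢-nonZero⁻¹ m)))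

  gcd-nonZeroʳ : ∀ m n .{{_ : NonZero n}} → NonZero (gcdℕ m n)
  gcd-nonZeroʳ m n = ≢-nonZero (gcd[m,n]≢0 m n (inj₂ (≢-nonZero⁻¹ n)))

  Hden-nonZero : ∀ x y s t .{{_ : NonZero ∣ y ∣}} .{{_ : NonZero ∣ t ∣}} → NonZero (Hden x y s t)
  Hden-nonZero x y s t =
    m*n≢0 _ _ {{m*n≢0 _ _ {{gcd-nonZeroʳ ∣ x ∣ ∣ t ∣}} {{gcd-nonZeroˡ ∣ y ∣ ∣ s ∣}}}} {{gcd-nonZeroˡ ∣ y ∣ ∣ t ∣}}

  coprime-divisors : ∀ {m n p q} → gcdℕ p q ≡ 1 → m ∣ p → n ∣ q → Coprime m n
  coprime-divisors gcd≡1 m∣p n∣q (d∣m , d∣n) = gcd≡1⇒coprime gcd≡1 (∣-trans d∣m m∣p , ∣-trans d∣n n∣q)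

  coprime-*-∣ : ∀ {m n k} → Coprime m n → m ∣ k → n ∣ k → m ℕ.* n ∣ k
  coprime-*-∣ {m} {n} m⊥n m∣k n∣k = subst (_∣ _) lcm≡m*n (lcm-least m∣k n∣k)
    where
    open ≡-Reasoning
    lcm≡m*n : lcm m n ≡ m ℕ.* n
    lcm≡m*n = begin
      lcm m n              ≡⟨ sym (*-identityˡ (lcm m n)) ⟩
      1 ℕ.* lcm m n        ≡⟨ cong (ℕ._* lcm m n) (sym (coprime⇒gcd≡1 m⊥n)) ⟩
      gcdℕ m n ℕ.* lcm m n ≡⟨ gcd*lcm m n ⟩
      m ℕ.* n              ∎

  Hden-squared-bound : ∀ x y s t → gcd x y ≡ 1ℤ → gcd s t ≡ 1ℤ →
    .{{_ : NonZero ∣ y ∣}} .{{_ : NonZero ∣ t ∣}} .{{_ : NonZero ∣ x ℤ.* s - y ℤ.* t ∣}} →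
    Hden x y s t ℕ.* Hden x y s t ≤ ∣ y ∣ ℕ.* ∣ t ∣ ℕ.* ∣ x ℤ.* s - y ℤ.* t ∣
  Hden-squared-bound x y s t x⊥y s⊥t =
    pairwise-products-bound {a} {b} {c} (∣⇒≤ bc∣y) (∣⇒≤ ac∣t) (∣⇒≤ ab∣xs-yt)
    where
    X Y S T a b c : ℕ
    X = ∣ x ∣ ; Y = ∣ y ∣ ; S = ∣ s ∣ ; T = ∣ t ∣
    a = gcdℕ X T ; b = gcdℕ Y S ; c = gcdℕ Y T
    X⊥Y : gcdℕ X Y ≡ 1
    X⊥Y = +-injective x⊥y
    S⊥T : gcdℕ S T ≡ 1
    S⊥T = +-injective s⊥t
    bc∣y : b ℕ.* c ∣ Y
    bc∣y = coprime-*-∣ (coprime-divisors S⊥T (gcd[m,n]∣n Y S) (gcd[m,n]∣n Y T)) (gcd[m,n]∣m Y S) (gcd[m,n]∣m Y T)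
    ac∣t : a ℕ.* c ∣ T
    ac∣t = coprime-*-∣ (coprime-divisors X⊥Y (gcd[m,n]∣m X T) (gcd[m,n]∣m Y T)) (gcd[m,n]∣n X T) (gcd[m,n]∣n Y T)
    ab∣xs-yt : a ℕ.* b ∣ ∣ x ℤ.* s - y ℤ.* t ∣
    ab∣xs-yt = coprime-*-∣ (coprime-divisors X⊥Y (gcd[m,n]∣m X T) (gcd[m,n]∣m Y S))
      (∣⇒∣ᵤ (∣m∣n⇒∣m-n (∣m⇒∣m*n s (∣ᵤ⇒∣ {+ a} {x} (gcd[m,n]∣m X T))) (∣n⇒∣m*n y (∣ᵤ⇒∣ {+ a} {t} (gcd[m,n]∣n X T)))))
      (∣⇒∣ᵤ (∣m∣n⇒∣m-n (∣n⇒∣m*n x (∣ᵤ⇒∣ {+ b} {s} (gcd[m,n]∣n Y S))) (∣m⇒∣m*n t (∣ᵤ⇒∣ {+ b} {y} (gcd[m,n]∣m Y S)))))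

  Hnum-lower-bound : ∀ x y s t → ∣ y ∣ ℕ.* ∣ y ∣ ℕ.* ∣ t ∣ ℕ.* ∣ t ∣ ≤ Hnum x y s t
  Hnum-lower-bound x y s t = begin
    ∣ y ∣ ℕ.* ∣ y ∣ ℕ.* ∣ t ∣ ℕ.* ∣ t ∣  ≡⟨ cong (λ n → n ℕ.* ∣ t ∣ ℕ.* ∣ t ∣) (abs-* y y) ⟨
    ∣ y ℤ.* y ∣ ℕ.* ∣ t ∣ ℕ.* ∣ t ∣      ≡⟨ cong (ℕ._* ∣ t ∣) (abs-* (y ℤ.* y) t) ⟨
    ∣ y ℤ.* y ℤ.* t ∣ ℕ.* ∣ t ∣          ≡⟨ abs-* (y ℤ.* y ℤ.* t) t ⟨
    ∣ y ℤ.* y ℤ.* t ℤ.* t ∣              ≤⟨ m≤n⊔m _ _ ⟩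
    Hnum x y s t                         ∎
    where open ≤-Reasoning

  cross-difference-bound : ∀ x y s t →
    ∣ x ℤ.* s - y ℤ.* t ∣ ≤ ∣ y ∣ ℕ.* ∣ s - t ∣ ℕ.+ ∣ x - y ∣ ℕ.* ∣ t ∣ ℕ.+ ∣ x - y ∣ ℕ.* ∣ s - t ∣
  cross-difference-bound x y s t = begin
    ∣ x ℤ.* s - y ℤ.* t ∣                ≡⟨ cong ∣_∣ (expand x y s t) ⟩
    ∣ A ℤ.+ B ℤ.+ C ∣                    ≤⟨ ∣i+j∣≤∣i∣+∣j∣ (A ℤ.+ B) C ⟩
    ∣ A ℤ.+ B ∣ ℕ.+ ∣ C ∣                ≤⟨ +-monoˡ-≤ ∣ C ∣ (∣i+j∣≤∣i∣+∣j∣ A B) ⟩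
    ∣ A ∣ ℕ.+ ∣ B ∣ ℕ.+ ∣ C ∣            ≡⟨ cong₂ ℕ._+_ (cong₂ ℕ._+_ (abs-* y (s - t)) (abs-* (x - y) t)) (abs-* (x - y) (s - t)) ⟩
    ∣ y ∣ ℕ.* ∣ s - t ∣ ℕ.+ ∣ x - y ∣ ℕ.* ∣ t ∣ ℕ.+ ∣ x - y ∣ ℕ.* ∣ s - t ∣ ∎
    where
    open ≤-Reasoning
    A B C : ℤ
    A = y ℤ.* (s - t) ; B = (x - y) ℤ.* t ; C = (x - y) ℤ.* (s - t)
    expand : ∀ x y s t → x ℤ.* s - y ℤ.* t ≡ y ℤ.* (s - t) ℤ.+ (x - y) ℤ.* t ℤ.+ (x - y) ℤ.* (s - t)
    expand = solve-∀

module Fractions where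
  open import Defs using (_/'_)
  open import Data.Nat as ℕ using (ℕ; suc; NonZero)
  import Data.Nat.Properties as ℕ
  open import Data.Integer as ℤ using (+_; -[1+_]; +≤+; +<+; -≤+)
  open import Data.Integer.Properties using (pos-*; drop‿+≤+)
  open import Data.Rational using (ℚ; mkℚ; ↥_; 0ℚ; _≤_; _<_; _*_; toℚᵘ)
  open import Data.Rational.Properties
    using (toℚᵘ-fromℚᵘ; toℚᵘ-injective; toℚᵘ-homo-*; toℚᵘ-cancel-≤; toℚᵘ-mono-≤; toℚᵘ-cancel-<)
  open import Data.Rational.Unnormalised as ℚᵘ using (mkℚᵘ; *≤*; *<*)
  import Data.Rational.Unnormalised.Properties as ℚᵘ
  open import Relation.Binary.PropositionalEquality

  frac : ℕ → ℕ → ℚ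
  frac a b = (+ a) /' b

  toℚᵘ-frac : ∀ a b → toℚᵘ (frac a (suc b)) ℚᵘ.≃ mkℚᵘ (+ a) b
  toℚᵘ-frac a b = toℚᵘ-fromℚᵘ (mkℚᵘ (+ a) b)

  frac-* : ∀ a c {b e} → frac a (suc b) * frac c (suc e) ≡ frac (a ℕ.* c) (suc b ℕ.* suc e)
  frac-* a c {b} {e} = toℚᵘ-injective (begin
    toℚᵘ (frac a (suc b) * frac c (suc e))           ≈⟨ toℚᵘ-homo-* (frac a (suc b)) (frac c (suc e)) ⟩
    toℚᵘ (frac a (suc b)) ℚᵘ.* toℚᵘ (frac c (suc e)) ≈⟨ ℚᵘ.*-cong (toℚᵘ-frac a b) (toℚᵘ-frac c e) ⟩
    mkℚᵘ (+ a) b ℚᵘ.* mkℚᵘ (+ c) e                   ≡⟨ cong (λ i → mkℚᵘ i _) (sym (pos-* a c)) ⟩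
    mkℚᵘ (+ (a ℕ.* c)) _                             ≈⟨ toℚᵘ-frac (a ℕ.* c) _ ⟨
    toℚᵘ (frac (a ℕ.* c) (suc b ℕ.* suc e))          ∎)
    where open ℚᵘ.≃-Reasoning

  frac-⁵ : ∀ a {b} → let d = frac a (suc b) in
    d * d * d * d * d ≡ frac (a ℕ.* a ℕ.* a ℕ.* a ℕ.* a) (suc b ℕ.* suc b ℕ.* suc b ℕ.* suc b ℕ.* suc b)
  frac-⁵ a {b} = begin
    d * d * d * d * d                                       ≡⟨ cong (λ p → p * d * d * d) (frac-* a a) ⟩
    frac (a ℕ.* a) (B ℕ.* B) * d * d * d                    ≡⟨ cong (λ p → p * d * d) (frac-* (a ℕ.* a) a) ⟩
    frac (a ℕ.* a ℕ.* a) (B ℕ.* B ℕ.* B) * d * d            ≡⟨ cong (_* d) (frac-* (a ℕ.* a ℕ.* a) a) ⟩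
    frac (a ℕ.* a ℕ.* a ℕ.* a) (B ℕ.* B ℕ.* B ℕ.* B) * d    ≡⟨ frac-* (a ℕ.* a ℕ.* a ℕ.* a) a ⟩
    frac (a ℕ.* a ℕ.* a ℕ.* a ℕ.* a) (B ℕ.* B ℕ.* B ℕ.* B ℕ.* B) ∎
    where
    open ≡-Reasoning
    B : ℕ
    B = suc b
    d : ℚ
    d = frac a B

  cross-≤⇒frac-≤ : ∀ a c {b e} → a ℕ.* suc e ℕ.≤ c ℕ.* suc b → frac a (suc b) ≤ frac c (suc e)
  cross-≤⇒frac-≤ a c {b} {e} ae≤cb = toℚᵘ-cancel-≤
    (ℚᵘ.≤-respʳ-≃ (ℚᵘ.≃-sym (toℚᵘ-frac c e)) (ℚᵘ.≤-respˡ-≃ (ℚᵘ.≃-sym (toℚᵘ-frac a b))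
      (*≤* (subst₂ ℤ._≤_ (pos-* a (suc e)) (pos-* c (suc b)) (+≤+ ae≤cb)))))

  frac-≤⇒cross-≤ : ∀ a c {b e} → frac a (suc b) ≤ frac c (suc e) → a ℕ.* suc e ℕ.≤ c ℕ.* suc b
  frac-≤⇒cross-≤ a c {b} {e} ab≤ce
    with ℚᵘ.≤-respʳ-≃ (toℚᵘ-frac c e) (ℚᵘ.≤-respˡ-≃ (toℚᵘ-frac a b) (toℚᵘ-mono-≤ ab≤ce))
  ... | *≤* ae≤cb = drop‿+≤+ (subst₂ ℤ._≤_ (sym (pos-* a (suc e))) (sym (pos-* c (suc b))) ae≤cb)

  p≤∣↥p∣ : ∀ p → p ≤ frac ℤ.∣ ↥ p ∣ 1
  p≤∣↥p∣ (mkℚ (+ n) d _) = toℚᵘ-cancel-≤ (ℚᵘ.≤-respʳ-≃ (ℚᵘ.≃-sym (toℚᵘ-frac n 0))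
    (*≤* (subst₂ ℤ._≤_ (pos-* n 1) (pos-* n (suc d)) (+≤+ (ℕ.*-monoʳ-≤ n (ℕ.s≤s ℕ.z≤n))))))
  p≤∣↥p∣ (mkℚ -[1+ n ] d _) = toℚᵘ-cancel-≤ (ℚᵘ.≤-respʳ-≃ (ℚᵘ.≃-sym (toℚᵘ-frac (suc n) 0)) (*≤* -≤+))

  0<frac-1 : ∀ k → 0ℚ < frac 1 (suc k)
  0<frac-1 k = toℚᵘ-cancel-< (ℚᵘ.<-respʳ-≃ (ℚᵘ.≃-sym (toℚᵘ-frac 1 k)) (*<* (+<+ (ℕ.s≤s ℕ.z≤n))))

  cross-≤⇒frac²frac⁵-≤ : ∀ N U {G Y K} .{{_ : NonZero G}} .{{_ : NonZero Y}} .{{_ : NonZero K}} →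
    G ℕ.* G ℕ.* (Y ℕ.* Y ℕ.* Y ℕ.* Y ℕ.* Y) ℕ.≤ N ℕ.* N ℕ.* (U ℕ.* U ℕ.* U ℕ.* U ℕ.* U) ℕ.* (K ℕ.* K) →
    frac 1 K * frac 1 K ≤
      frac N G * frac N G * (frac U Y * frac U Y * frac U Y * frac U Y * frac U Y)
  cross-≤⇒frac²frac⁵-≤ N U {G@(suc g)} {Y@(suc y)} {K@(suc k)} ineq =
    subst₂ _≤_ (sym (frac-* 1 1 {k} {k})) (sym collect)
      (cross-≤⇒frac-≤ 1 (N ℕ.* N ℕ.* (U ℕ.* U ℕ.* U ℕ.* U ℕ.* U)) (ℕ.≤-trans (ℕ.≤-reflexive (ℕ.*-identityˡ _)) ineq))
    where
    collect : frac N G * frac N G * (frac U Y * frac U Y * frac U Y * frac U Y * frac U Y)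
            ≡ frac (N ℕ.* N ℕ.* (U ℕ.* U ℕ.* U ℕ.* U ℕ.* U)) (G ℕ.* G ℕ.* (Y ℕ.* Y ℕ.* Y ℕ.* Y ℕ.* Y))
    collect = trans (cong₂ _*_ (frac-* N N {g} {g}) (frac-⁵ U {y})) (frac-* (N ℕ.* N) (U ℕ.* U ℕ.* U ℕ.* U ℕ.* U))

module HeightDistance where
  open Arithmetic using (cross-difference-linear-bound; height-distance-inequality)
  open Fractions
  open import Data.Nat as ℕ using (suc; NonZero)
  import Data.Nat.Properties as ℕ
  open import Data.Nat.Tactic.RingSolver using (solve-∀)
  open import Data.Rational using (_≤_; _*_; _⊔_)
  open import Data.Rational.Properties using (≤-total; p≤q⇒p⊔q≡q; p≥q⇒p⊔q≡p)
  open import Data.Sum using (inj₁; inj₂)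
  open import Relation.Binary.PropositionalEquality using (_≡_; subst)

  ordered-height-distance-bound : ∀ {N G Y T U V W} m
    .{{_ : NonZero G}} .{{_ : NonZero Y}} .{{_ : NonZero T}} .{{_ : NonZero U}} .{{_ : NonZero V}} →
    G ℕ.* G ℕ.≤ Y ℕ.* T ℕ.* W → Y ℕ.* Y ℕ.* T ℕ.* T ℕ.≤ N → W ℕ.≤ Y ℕ.* V ℕ.+ U ℕ.* T ℕ.+ U ℕ.* V →
    frac V T ≤ frac U Y → frac U Y ≤ frac m 1 →
    frac 1 (suc (suc m)) * frac 1 (suc (suc m)) ≤
      frac N G * frac N G * (frac U Y * frac U Y * frac U Y * frac U Y * frac U Y)
  ordered-height-distance-bound {N} {G} {Y@(suc _)} {T@(suc _)} {U} {V} {W} m G²≤ Y²T²≤N W≤ VT≤UY UY≤m =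
    cross-≤⇒frac²frac⁵-≤ N U {G} {Y} {suc (suc m)} (height-distance-inequality {N} {G} {Y} {T} {U} {W} G²≤ Y²T²≤N
      (cross-difference-linear-bound m W≤ VY≤UT U≤mY) (ℕ.≤-trans (ℕ.m≤n*m Y V) VY≤UT))
    where
    VY≤UT : V ℕ.* Y ℕ.≤ U ℕ.* T
    VY≤UT = frac-≤⇒cross-≤ V U VT≤UY
    U≤mY : U ℕ.≤ m ℕ.* Y
    U≤mY = subst (ℕ._≤ m ℕ.* Y) (ℕ.*-identityʳ U) (frac-≤⇒cross-≤ U m UY≤m)

  height-distance-bound : ∀ {N G Y T U V W} m
    .{{_ : NonZero G}} .{{_ : NonZero Y}} .{{_ : NonZero T}} .{{_ : NonZero U}} .{{_ : NonZero V}} →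
    G ℕ.* G ℕ.≤ Y ℕ.* T ℕ.* W → Y ℕ.* Y ℕ.* T ℕ.* T ℕ.≤ N → W ℕ.≤ Y ℕ.* V ℕ.+ U ℕ.* T ℕ.+ U ℕ.* V →
    frac U Y ⊔ frac V T ≤ frac m 1 →
    frac 1 (suc (suc m)) * frac 1 (suc (suc m)) ≤
      frac N G * frac N G * ((frac U Y ⊔ frac V T) * (frac U Y ⊔ frac V T) * (frac U Y ⊔ frac V T)
        * (frac U Y ⊔ frac V T) * (frac U Y ⊔ frac V T))
  height-distance-bound {N} {G} {Y} {T} {U} {V} {W} m G²≤ Y²T²≤N W≤ d≤m
    with ≤-total (frac V T) (frac U Y)
  ... | inj₁ VT≤UY rewrite p≥q⇒p⊔q≡p VT≤UY =
    ordered-height-distance-bound m G²≤ Y²T²≤N W≤ VT≤UY d≤m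
  ... | inj₂ UY≤VT rewrite p≤q⇒p⊔q≡q UY≤VT =
    ordered-height-distance-bound {N} {G} {T} {Y} {V} {U} {W} m
      (subst (λ n → G ℕ.* G ℕ.≤ n ℕ.* W) (ℕ.*-comm Y T) G²≤)
      (subst (ℕ._≤ N) (swap-squares Y T) Y²T²≤N)
      (subst (W ℕ.≤_) (swap-cross-terms Y T U V) W≤)
      UY≤VT d≤m
    where
    swap-squares : ∀ Y T → Y ℕ.* Y ℕ.* T ℕ.* T ≡ T ℕ.* T ℕ.* Y ℕ.* Y
    swap-squares = solve-∀
    swap-cross-terms : ∀ Y T U V → Y ℕ.* V ℕ.+ U ℕ.* T ℕ.+ U ℕ.* V ≡ T ℕ.* U ℕ.+ V ℕ.* Y ℕ.+ V ℕ.* U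
    swap-cross-terms = solve-∀

open import Defs
open import Data.Product using (Σ; _×_)
open import Relation.Binary.PropositionalEquality using (_≡_; _≢_)
open import Data.Integer using (ℤ; 0ℤ; 1ℤ; _*_)
open import Data.Integer.GCD using (gcd)
open import Data.Rational using (ℚ; 0ℚ; _<_; _≤_) renaming (_*_ to _*ℚ_)

import Data.Nat as ℕ
import Data.Integer as ℤ
open import Data.Product using (_,_)
open import Data.Rational using (↥_)
open import Data.Rational.Properties using (≤-trans)
open PointInvariants
open Fractions using (frac; p≤∣↥p∣; 0<frac-1)
open HeightDistance using (height-distance-bound)

height-distance-bound-at : ∀ m (x y s t : ℤ) → gcd x y ≡ 1ℤ → gcd s t ≡ 1ℤ →
  y ≢ 0ℤ → t ≢ 0ℤ → x ≢ y → s ≢ t → x * s ≢ y * t →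
  dQ x y s t ≤ frac m 1 →
  frac 1 (ℕ.suc (ℕ.suc m)) *ℚ frac 1 (ℕ.suc (ℕ.suc m)) ≤ (H x y s t *ℚ H x y s t) *ℚ
    (dQ x y s t *ℚ dQ x y s t *ℚ dQ x y s t *ℚ dQ x y s t *ℚ dQ x y s t)
height-distance-bound-at m x y s t x⊥y s⊥t y≢0 t≢0 x≢y s≢t xs≢yt d≤m =
  height-distance-bound {Hnum x y s t} {Hden x y s t} {Y} {T} {U} {V} {W} m
    (Hden-squared-bound x y s t x⊥y s⊥t) (Hnum-lower-bound x y s t) (cross-difference-bound x y s t) d≤m
  where
  Y T U V W : ℕ.ℕ
  Y = ℤ.∣ y ∣ ; T = ℤ.∣ t ∣ ; U = ℤ.∣ x ℤ.- y ∣ ; V = ℤ.∣ s ℤ.- t ∣ ; W = ℤ.∣ x * s ℤ.- y * t ∣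
  instance
    Y≢0 : ℕ.NonZero Y
    Y≢0 = ∣∣-nonZero y≢0
    T≢0 : ℕ.NonZero T
    T≢0 = ∣∣-nonZero t≢0
    U≢0 : ℕ.NonZero U
    U≢0 = ∣-∣-nonZero x≢y
    V≢0 : ℕ.NonZero V
    V≢0 = ∣-∣-nonZero s≢t
    W≢0 : ℕ.NonZero W
    W≢0 = ∣-∣-nonZero xs≢yt
    Hden≢0 : ℕ.NonZero (Hden x y s t)
    Hden≢0 = Hden-nonZero x y s t

proposition4p2 : (C : ℚ) → 0ℚ < C →
    Σ ℚ (λ D → 0ℚ < D ×
      ((x y s t : ℤ) → gcd x y ≡ 1ℤ → gcd s t ≡ 1ℤ →
        y ≢ 0ℤ → t ≢ 0ℤ →
        x ≢ y → s ≢ t → x * s ≢ y * t →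
        dQ x y s t ≤ C →
        D *ℚ D ≤ (H x y s t *ℚ H x y s t) *ℚ
          (dQ x y s t *ℚ dQ x y s t *ℚ dQ x y s t *ℚ dQ x y s t *ℚ dQ x y s t)))
proposition4p2 C _ = frac 1 (ℕ.suc (ℕ.suc m)) , 0<frac-1 (ℕ.suc m) ,
  λ x y s t x⊥y s⊥t y≢0 t≢0 x≢y s≢t xs≢yt d≤C →
    height-distance-bound-at m x y s t x⊥y s⊥t y≢0 t≢0 x≢y s≢t xs≢yt (≤-trans d≤C (p≤∣↥p∣ C))
  where
  m = ℤ.∣ ↥ C ∣
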